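{- For any apex graph $A$ and any $A$-minor-free graph $G$, $\mathrm{ttw}(G)\leq g(A,2)$.
   Context: All graphs are finite, simple and undirected. A graph $A$ is apex if $A-z$ is planar for some vertex $z\in V(A)$. A graph $A$ is a minor of $G$ if a graph isomorphic to $A$ can be obtained from a subgraph of $G$ by contracting edges; $G$ is $A$-minor-free if $A$ is not a minor of $G$. The radius of a connected graph $G$ is $\min_{\alpha\in V(G)}\max_{v\in V(G)}\mathrm{dist}_G(\alpha,v)$. For an apex graph $A$ and integer $r\geq0$, $g(A,r)$ denotes the maximum treewidth of an $A$-minor-free graph with radius at most $r$ (it is known that this maximum is finite). A tree-decomposition of $G$ is a tree $T$ with bags $(B_x\subseteq V(G):x\in V(T))$ such that every vertex lies in some bag, each edge has both ends in some bag, and for each vertex $v$ the set $\{x:v\in B_x\}$ induces a connected subtree of $T$. The tree-treewidth $\mathrm{ttw}(G)$ is the minimum integer $k$ such that $G$ has a tree-decomposition $(B_x:x\in V(T))$ with $\mathrm{tw}(G[B_x])\leq k$ for every node $x\in V(T)$, where $\mathrm{tw}$ denotes treewidth. -}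

module Defs where

open import Data.Nat using (ℕ; zero; suc; _≤_; _<ᵇ_)
open import Data.Bool using (Bool; true; false; not; _xor_)
open import Data.Fin using (Fin; toℕ)
open import Data.Fin.Properties using (_≟_)
open import Data.Fin.Subset using (Subset; _∈_; _∉_; ∣_∣; ∁; ⁅_⁆) renaming (⊤ to Full)
open import Data.List using (List; []; _∷_; length; foldl)
open import Data.List.Relation.Unary.Linked using (Linked)
open import Data.List.Relation.Unary.Unique.Propositional using (Unique)
open import Data.List.Relation.Unary.All using (All)
open import Data.Product using (Σ; ∃; ∃-syntax; _×_; _,_)
open import Data.Empty using (⊥)
open import Relation.Nullary using (¬_; does; yes; no)
open import Relation.Binary.PropositionalEquality using (_≡_; _≢_; refl; sym)

record Graph : Set where
  field
    n      : ℕ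
    adj    : Fin n → Fin n → Bool
    adj-sym    : ∀ u v → adj u v ≡ adj v u
    adj-irrefl : ∀ v → adj v v ≡ false
open Graph public

Edge : (G : Graph) → Fin (n G) → Fin (n G) → Set
Edge G u v = adj G u v ≡ true

data Walk (G : Graph) (P : Fin (n G) → Set) : Fin (n G) → Fin (n G) → ℕ → Set where
  here : ∀ {v} → P v → Walk G P v v 0
  step : ∀ {u w v k} → P u → Edge G u w → Walk G P w v k → Walk G P u v (suc k)

ConnectedOn : (G : Graph) → (Fin (n G) → Set) → Set
ConnectedOn G P = ∀ u v → P u → P v → ∃[ k ] Walk G P u v k

Connected : Graph → Set
Connected G = ConnectedOn G (_∈ Full)

-- radius of G is at most r: some centre α with dist(α,v) ≤ r for all v
-- (this forces G to be connected and non-empty)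
RadiusAtMost : Graph → ℕ → Set
RadiusAtMost G r = ∃[ α ] ∀ v → ∃[ k ] (k ≤ r × Walk G (_∈ Full) α v k)

-- a cycle: distinct vertices v0,…,vm (m ≥ 2), consecutive adjacent, vm ~ v0
record Cycle (G : Graph) : Set where
  field
    v₀ v₁ v₂ : Fin (n G)
    rest     : List (Fin (n G))
    distinct : Unique (v₀ ∷ v₁ ∷ v₂ ∷ rest)
    linked   : Linked (Edge G) (v₀ ∷ v₁ ∷ v₂ ∷ rest)
    closing  : Edge G (foldl (λ _ x → x) v₂ rest) v₀

IsTree : Graph → Set
IsTree T = (Σ (Fin (n T)) λ x → x ∈ Full) × Connected T × ¬ Cycle T

record TreeDecompOn (G : Graph) (S : Subset (n G)) : Set where
  field
    T      : Graph
    isTree : IsTree T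
    bag    : Fin (n T) → Subset (n G)
    bag⊆S  : ∀ x v → v ∈ bag x → v ∈ S
    cover  : ∀ v → v ∈ S → ∃[ x ] v ∈ bag x
    edges  : ∀ u v → u ∈ S → v ∈ S → Edge G u v → ∃[ x ] (u ∈ bag x × v ∈ bag x)
    subtree : ∀ v → ConnectedOn T (λ x → v ∈ bag x)

TreewidthOnAtMost : (G : Graph) → Subset (n G) → ℕ → Set
TreewidthOnAtMost G S k =
  Σ (TreeDecompOn G S) λ D → ∀ x → ∣ TreeDecompOn.bag D x ∣ ≤ suc k

TreewidthAtMost : Graph → ℕ → Set
TreewidthAtMost G k = TreewidthOnAtMost G Full k

TreeTreewidthAtMost : Graph → ℕ → Set
TreeTreewidthAtMost G k =
  Σ (TreeDecompOn G Full) λ D → ∀ x → TreewidthOnAtMost G (TreeDecompOn.bag D x) k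

record MinorModelOn (H G : Graph) (S : Subset (n G)) : Set where
  field
    branch    : Fin (n H) → Subset (n G)
    branch⊆S  : ∀ h v → v ∈ branch h → v ∈ S
    nonempty  : ∀ h → ∃[ v ] v ∈ branch h
    disjoint  : ∀ h h' v → v ∈ branch h → v ∈ branch h' → h ≡ h'
    connected : ∀ h → ConnectedOn G (_∈ branch h)
    edges     : ∀ h h' → Edge H h h' →
                ∃[ u ] ∃[ v ] (u ∈ branch h × v ∈ branch h' × Edge G u v)

IsMinorOn : Graph → (G : Graph) → Subset (n G) → Set
IsMinorOn H G S = MinorModelOn H G S

IsMinor : Graph → Graph → Set
IsMinor H G = IsMinorOn H G Full

neq : ∀ {m} → Fin m → Fin m → Bool
neq u v = not (does (u ≟ v))

neq-sym : ∀ {m} (u v : Fin m) → neq u v ≡ neq v u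
neq-sym u v with u ≟ v | v ≟ u
... | yes _ | yes _ = refl
... | no _  | no _  = refl
... | yes p | no q  with q (sym p)
... | ()
neq-sym u v | no q | yes p with q (sym p)
... | ()

neq-irrefl : ∀ {m} (v : Fin m) → neq v v ≡ false
neq-irrefl v with v ≟ v
... | yes _ = refl
... | no q with q refl
... | ()

K5 : Graph
K5 = record { n = 5 ; adj = neq ; adj-sym = neq-sym ; adj-irrefl = neq-irrefl }

side : Fin 6 → Bool
side v = toℕ v <ᵇ 3

xor-comm : ∀ a b → (a xor b) ≡ (b xor a)
xor-comm true true = refl
xor-comm true false = refl
xor-comm false true = refl
xor-comm false false = refl

xor-self : ∀ a → (a xor a) ≡ false
xor-self true = refl
xor-self false = refl

K33 : Graph
K33 = record { n = 6 ; adj = λ u v → side u xor side v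
             ; adj-sym = λ u v → xor-comm (side u) (side v)
             ; adj-irrefl = λ v → xor-self (side v) }

-- Planarity (combinatorially, via Wagner's theorem) and apex graphs

PlanarOn : (G : Graph) → Subset (n G) → Set
PlanarOn G S = ¬ IsMinorOn K5 G S × ¬ IsMinorOn K33 G S

IsApex : Graph → Set
IsApex A = ∃[ z ] PlanarOn A (∁ ⁅ z ⁆)

-- Run a breadth-first search through G, one component after another, and let the layer of a
-- vertex be the step at which the search reaches it; closing a component costs a step of its
-- own, so an empty layer separates consecutive components. Edges join equal or consecutive
-- layers, hence the unions of two consecutive layers are the bags of a tree-decomposition
-- along a path. Such a bag B lies in one component, and the earlier layers of that component
-- form a connected ball next to B. Contracting this ball to a single vertex and discarding
-- everything outside B yields a minor of G, so an A-minor-free graph, of radius at most 2;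
-- hence tw(G[B]) ≤ g(A, 2). When B starts at the root of a component, the root itself plays
-- the role of the contracted ball.
module Submission where

open import Defs
open import Data.Bool using (Bool; true; false)
import Data.Bool as Bool
open import Data.Bool.Properties using (∨-comm)
open import Data.Empty using (⊥-elim)
open import Data.Fin using (Fin; zero; suc; toℕ; fromℕ<)
open import Data.Fin.Induction using (<-weakInduction)
open import Data.Fin.Properties using (toℕ-injective; toℕ-fromℕ<; toℕ-inject₁; any?; injective⇒≤)
import Data.Fin.Properties as Finₚ
open import Data.Fin.Subset
  using (Subset; _∈_; _∉_; _⊆_; ∣_∣; ⁅_⁆; _∪_; _∩_; ∁; Nonempty; Empty)
  renaming (⊤ to Full; ⊥ to ∅)
open import Data.Fin.Subset.Properties
  using (_∈?_; nonempty?; ∈⊤; ∉⊥; x∈⁅x⁆; x∈⁅y⁆⇒x≡y; ∣⁅x⁆∣≡1; ∣⊥∣≡0; ∣p∣≤n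
        ; p⊆p∪q; q⊆p∪q; x∈p∪q⁻; x∈p∩q⁺; x∈p∩q⁻; x∈∁p⇒x∉p; x∉p⇒x∈∁p; x∉∁p⇒x∈p
        ; p⊆q⇒∣p∣≤∣q∣; p⊂q⇒∣p∣<∣q∣)
open import Data.List using (List; []; _∷_; foldl)
open import Data.List.Relation.Unary.All using (_∷_)
open import Data.List.Relation.Unary.AllPairs using (_∷_)
open import Data.List.Relation.Unary.Linked as Linked using (Linked; [-]; _∷_)
open import Data.List.Relation.Unary.Unique.Propositional using (Unique)
open import Data.Nat using (ℕ; zero; suc; _+_; _≤_; _<_; _≟_; _<?_; _≤′_; ≤′-refl; ≤′-step; z≤n; s≤s)
open import Data.Nat.Properties
  using (≤-refl; ≤-reflexive; ≤-trans; ≤-antisym; ≤-total; ≤-pred; <-trans; <-irrefl; ≮⇒≥; ≤⇒≤′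
        ; m≤n⇒m<n∨m≡n; suc-injective; 1+n≢n; 1+n≰n; +-mono-≤; +-mono-<-≤; +-monoʳ-<)
open import Data.Product using (∃; ∃-syntax; _×_; _,_; proj₁; proj₂)
open import Data.Sum using (_⊎_; inj₁; inj₂; [_,_]′; swap)
import Data.Sum as Sum
open import Data.Vec using (tabulate; _∷_; here; there)
open import Data.Vec.Properties using (lookup∘tabulate; []=⇒lookup; lookup⇒[]=)
open import Data.Vec.Properties.WithK using ([]=-irrelevant)
open import Function using (_∘_; flip)
open import Relation.Binary.PropositionalEquality
  using (_≡_; refl; sym; trans; cong; subst; subst₂; module ≡-Reasoning)
open import Relation.Nullary using (¬_; Dec; yes; no; does)
open import Relation.Nullary.Decidable using (dec-true; dec-false; _×-dec_; _⊎-dec_; ¬?; decidable-stable)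
open import Relation.Unary using (Decidable)

witness : ∀ {A : Set} (a? : Dec A) → does a? ≡ true → A
witness (yes a) _ = a
witness (no _) ()

toSubset : ∀ {m} {P : Fin m → Set} → Decidable P → Subset m
toSubset P? = tabulate (λ v → does (P? v))

module _ {m} {P : Fin m → Set} (P? : Decidable P) where

  ∈-toSubset⁺ : ∀ {v} → P v → v ∈ toSubset P?
  ∈-toSubset⁺ {v} p = lookup⇒[]= v _ (trans (lookup∘tabulate _ v) (dec-true (P? v) p))

  ∈-toSubset⁻ : ∀ {v} → v ∈ toSubset P? → P v
  ∈-toSubset⁻ {v} v∈ = witness (P? v) (trans (sym (lookup∘tabulate _ v)) ([]=⇒lookup v∈))

crossing : ∀ {P : ℕ → Set} → Decidable P → ¬ P 0 → ∀ {T} → P T → ∃[ t ] (¬ P t × P (suc t))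
crossing P? ¬P0 {zero}  PT = ⊥-elim (¬P0 PT)
crossing P? ¬P0 {suc T} PT with P? T
... | yes PT′ = crossing P? ¬P0 PT′
... | no ¬PT′ = T , ¬PT′ , PT

x∈p∪q∧x∉p⇒x∈q : ∀ {m} {p q : Subset m} {x} → x ∉ p → x ∈ p ∪ q → x ∈ q
x∈p∪q∧x∉p⇒x∈q {p = p} {q} x∉p x∈p∪q =
  [ (λ x∈p → ⊥-elim (x∉p x∈p)) , (λ x∈q → x∈q) ]′ (x∈p∪q⁻ p q x∈p∪q)

x∈q∧x∉p⇒∣p∣<∣p∪q∣ : ∀ {m} {p q : Subset m} {x} → x ∈ q → x ∉ p → ∣ p ∣ < ∣ p ∪ q ∣
x∈q∧x∉p⇒∣p∣<∣p∪q∣ {p = p} {q} {x} x∈q x∉p = p⊂q⇒∣p∣<∣q∣ (p⊆p∪q q , x , q⊆p∪q p q x∈q , x∉p)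

enum : ∀ {m} (p : Subset m) → Fin ∣ p ∣ → Fin m
enum (true  ∷ p) zero    = zero
enum (true  ∷ p) (suc i) = suc (enum p i)
enum (false ∷ p) i       = suc (enum p i)

index : ∀ {m} (p : Subset m) {x} → x ∈ p → Fin ∣ p ∣
index (true  ∷ p) here       = zero
index (true  ∷ p) (there x∈) = suc (index p x∈)
index (false ∷ p) (there x∈) = index p x∈

enum-∈ : ∀ {m} (p : Subset m) i → enum p i ∈ p
enum-∈ (true  ∷ p) zero    = here
enum-∈ (true  ∷ p) (suc i) = there (enum-∈ p i)
enum-∈ (false ∷ p) i       = there (enum-∈ p i)

enum-index : ∀ {m} (p : Subset m) {x} (x∈p : x ∈ p) → enum p (index p x∈p) ≡ x
enum-index (true  ∷ p) here       = refl
enum-index (true  ∷ p) (there x∈) = cong suc (enum-index p x∈)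
enum-index (false ∷ p) (there x∈) = cong suc (enum-index p x∈)

index-enum : ∀ {m} (p : Subset m) i → index p (enum-∈ p i) ≡ i
index-enum (true  ∷ p) zero    = refl
index-enum (true  ∷ p) (suc i) = cong suc (index-enum p i)
index-enum (false ∷ p) i       = index-enum p i

index-cong : ∀ {m} (p : Subset m) {x y} (x∈p : x ∈ p) (y∈p : y ∈ p) →
             x ≡ y → index p x∈p ≡ index p y∈p
index-cong p x∈p y∈p refl = cong (index p) ([]=-irrelevant x∈p y∈p)

enum-injective : ∀ {m} (p : Subset m) {i j} → enum p i ≡ enum p j → i ≡ j
enum-injective p {i} {j} eq = begin
  i                       ≡⟨ sym (index-enum p i) ⟩
  index p (enum-∈ p i)    ≡⟨ index-cong p _ _ eq ⟩
  index p (enum-∈ p j)    ≡⟨ index-enum p j ⟩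
  j                       ∎
  where open ≡-Reasoning

injective⇒∣p∣≤∣q∣ : ∀ {m m′} {p : Subset m} {q : Subset m′} (φ : Fin m → Fin m′) →
                    (∀ {x} → x ∈ p → φ x ∈ q) → (∀ {x y} → x ∈ p → y ∈ p → φ x ≡ φ y → x ≡ y) →
                    ∣ p ∣ ≤ ∣ q ∣
injective⇒∣p∣≤∣q∣ {p = p} {q} φ maps-into injective = injective⇒≤ λ {i} {j} eq →
  enum-injective p (injective (enum-∈ p i) (enum-∈ p j) (begin
    φ (enum p i)                              ≡⟨ sym (enum-index q _) ⟩
    enum q (index q (maps-into (enum-∈ p i))) ≡⟨ cong (enum q) eq ⟩
    enum q (index q (maps-into (enum-∈ p j))) ≡⟨ enum-index q _ ⟩
    φ (enum p j)                              ∎))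
  where open ≡-Reasoning

module _ (G : Graph) where

  edge-sym : ∀ {u v} → Edge G u v → Edge G v u
  edge-sym {u} {v} e = trans (adj-sym G v u) e

  edge-irrefl : ∀ {v} → ¬ Edge G v v
  edge-irrefl {v} e with trans (sym e) (adj-irrefl G v)
  ... | ()

  edge? : ∀ u v → Dec (Edge G u v)
  edge? u v = adj G u v Bool.≟ true

  AdjacentTo : Fin (n G) → Subset (n G) → Set
  AdjacentTo v R = ∃[ w ] (w ∈ R × Edge G v w)

  adjacentTo? : ∀ v R → Dec (AdjacentTo v R)
  adjacentTo? v R = any? (λ w → (w ∈? R) ×-dec edge? v w)

  Reach : (Fin (n G) → Set) → Fin (n G) → Fin (n G) → Set
  Reach P u v = ∃[ k ] Walk G P u v k

  module _ {P : Fin (n G) → Set} where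

    walk-start : ∀ {u v k} → Walk G P u v k → P u
    walk-start (here p)     = p
    walk-start (step p _ _) = p

    reach-refl : ∀ {u} → P u → Reach P u u
    reach-refl p = 0 , here p

    reach-edge : ∀ {u v} → P u → P v → Edge G u v → Reach P u v
    reach-edge pu pv e = 1 , step pu e (here pv)

    reach-trans : ∀ {u v w} → Reach P u v → Reach P v w → Reach P u w
    reach-trans (_ , here _)        r = r
    reach-trans (_ , step pu e wlk) r =
      let (k , wlk′) = reach-trans (_ , wlk) r in suc k , step pu e wlk′

    reach-sym : ∀ {u v} → Reach P u v → Reach P v u
    reach-sym (_ , here p)        = reach-refl p
    reach-sym (_ , step pu e wlk) =
      reach-trans (reach-sym (_ , wlk)) (reach-edge (walk-start wlk) pu (edge-sym e))

    reach-mono : ∀ {Q : Fin (n G) → Set} → (∀ {x} → P x → Q x) →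
                 ∀ {u v} → Reach P u v → Reach Q u v
    reach-mono {Q} P⊆Q (k , wlk) = k , map wlk
      where
      map : ∀ {u v k} → Walk G P u v k → Walk G Q u v k
      map (here p)        = here (P⊆Q p)
      map (step pu e wlk) = step (P⊆Q pu) e (map wlk)

  ⁅⁆-connected : ∀ x → ConnectedOn G (_∈ ⁅ x ⁆)
  ⁅⁆-connected x u v u∈ v∈ with x∈⁅y⁆⇒x≡y x u∈ | x∈⁅y⁆⇒x≡y x v∈
  ... | refl | refl = reach-refl u∈

-- A repetition-free walk along ≺ ∪ ≻ that starts with a ≺-step must keep going along ≺, as
-- ≺-predecessors are unique; so it cannot close up, by ≺ ⊆ < and uniqueness of ≺-successors.
module NoBacktracking {X : Set} (_≺_ _<_ : X → X → Set)
  (≺⇒< : ∀ {x y} → x ≺ y → x < y)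
  (<-trans : ∀ {x y z} → x < y → y < z → x < z)
  (<-irrefl : ∀ {x} → ¬ x < x)
  (pred-unique : ∀ {x y z} → x ≺ z → y ≺ z → x ≡ y)
  (succ-unique : ∀ {x y z} → x ≺ y → x ≺ z → y ≡ z)
  where

  _∼_ : X → X → Set
  x ∼ y = x ≺ y ⊎ y ≺ x

  last : X → List X → X
  last = foldl (λ _ x → x)

  straight : ∀ {x y} zs → Linked _∼_ (x ∷ y ∷ zs) → Unique (x ∷ y ∷ zs) →
             x ≺ y → Linked _≺_ (x ∷ y ∷ zs)
  straight []       _                _                         x≺y = x≺y ∷ [-]
  straight (z ∷ zs) (_ ∷ y∼z ∷ ∼zs) ((_ ∷ x≢z ∷ _) ∷ distinct) x≺y with y∼z
  ... | inj₁ y≺z = x≺y ∷ straight zs (y∼z ∷ ∼zs) distinct y≺z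
  ... | inj₂ z≺y = ⊥-elim (x≢z (pred-unique x≺y z≺y))

  last-above : ∀ {y z} zs → Linked _≺_ (y ∷ z ∷ zs) → y < last z zs
  last-above []       (y≺z ∷ [-]) = ≺⇒< y≺z
  last-above (_ ∷ ws) (y≺z ∷ ≺ws) = <-trans (≺⇒< y≺z) (last-above ws ≺ws)

  no-cycle : ∀ {v₀ v₁ v₂} rest → Linked _∼_ (v₀ ∷ v₁ ∷ v₂ ∷ rest) →
             Unique (v₀ ∷ v₁ ∷ v₂ ∷ rest) → last v₂ rest ∼ v₀ → ¬ v₀ ≺ v₁
  no-cycle rest ∼vs distinct closing v₀≺v₁ with straight (_ ∷ rest) ∼vs distinct v₀≺v₁ | closing
  ... | _ ∷ ≺vs | inj₁ last≺v₀ =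
    <-irrefl (<-trans (≺⇒< last≺v₀) (<-trans (≺⇒< v₀≺v₁) (last-above rest ≺vs)))
  ... | _ ∷ ≺vs | inj₂ v₀≺last =
    <-irrefl (subst (_ <_) (sym (succ-unique v₀≺v₁ v₀≺last)) (last-above rest ≺vs))

_⋖_ : ∀ {M} → Fin M → Fin M → Set
i ⋖ j = suc (toℕ i) ≡ toℕ j

_⋖?_ : ∀ {M} (i j : Fin M) → Dec (i ⋖ j)
i ⋖? j = suc (toℕ i) ≟ toℕ j

Path : ℕ → Graph
Path M = record
  { n          = M
  ; adj        = λ i j → does ((i ⋖? j) ⊎-dec (j ⋖? i))
  ; adj-sym    = λ i j → ∨-comm (does (i ⋖? j)) (does (j ⋖? i))
  ; adj-irrefl = λ i → dec-false ((i ⋖? i) ⊎-dec (i ⋖? i)) [ 1+n≢n , 1+n≢n ]′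
  }

module _ {M : ℕ} where

  path-edge⁻ : ∀ {i j} → Edge (Path M) i j → i ⋖ j ⊎ j ⋖ i
  path-edge⁻ {i} {j} = witness ((i ⋖? j) ⊎-dec (j ⋖? i))

  path-edge⁺ : ∀ {i j} → i ⋖ j → Edge (Path M) i j
  path-edge⁺ {i} {j} i⋖j = dec-true ((i ⋖? j) ⊎-dec (j ⋖? i)) (inj₁ i⋖j)

  private
    ⋖-pred-unique : ∀ {i j k : Fin M} → i ⋖ k → j ⋖ k → i ≡ j
    ⋖-pred-unique i⋖k j⋖k = toℕ-injective (suc-injective (trans i⋖k (sym j⋖k)))

    ⋖-succ-unique : ∀ {i j k : Fin M} → i ⋖ j → i ⋖ k → j ≡ k
    ⋖-succ-unique i⋖j i⋖k = toℕ-injective (trans (sym i⋖j) i⋖k)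

    module Ascending = NoBacktracking _⋖_ (λ i j → toℕ i < toℕ j)
      ≤-reflexive <-trans (<-irrefl refl) ⋖-pred-unique ⋖-succ-unique
    module Descending = NoBacktracking (flip _⋖_) (λ i j → toℕ j < toℕ i)
      ≤-reflexive (flip <-trans) (<-irrefl refl) ⋖-succ-unique ⋖-pred-unique

  path-acyclic : ¬ Cycle (Path M)
  path-acyclic c =
    [ Ascending.no-cycle rest (Linked.map path-edge⁻ linked) distinct (path-edge⁻ closing)
    , Descending.no-cycle rest (Linked.map (swap ∘ path-edge⁻) linked) distinct
                          (swap (path-edge⁻ closing))
    ]′ (path-edge⁻ (Linked.head linked))
    where open Cycle c

path-isTree : ∀ M → IsTree (Path (suc M))
path-isTree M = (zero , ∈⊤) , connected , path-acyclic
  where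
  from-zero : ∀ i → Reach (Path (suc M)) (_∈ Full) zero i
  from-zero = <-weakInduction _ (reach-refl _ ∈⊤) λ i r →
    reach-trans _ r (reach-edge _ ∈⊤ ∈⊤ (path-edge⁺ (cong suc (toℕ-inject₁ i))))

  connected : Connected (Path (suc M))
  connected u v _ _ = reach-trans _ (reach-sym _ (from-zero u)) (from-zero v)

module _ (G : Graph) where

  twoLayers : (Fin (n G) → ℕ) → ℕ → Subset (n G)
  twoLayers h t = toSubset (λ v → (h v ≟ t) ⊎-dec (h v ≟ suc t))

  module _ (h : Fin (n G) → ℕ) (t : ℕ) where

    ∈-twoLayers⁺ : ∀ {v} → h v ≡ t ⊎ h v ≡ suc t → v ∈ twoLayers h t
    ∈-twoLayers⁺ = ∈-toSubset⁺ (λ v → (h v ≟ t) ⊎-dec (h v ≟ suc t))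

    ∈-twoLayers⁻ : ∀ {v} → v ∈ twoLayers h t → h v ≡ t ⊎ h v ≡ suc t
    ∈-twoLayers⁻ = ∈-toSubset⁻ (λ v → (h v ≟ t) ⊎-dec (h v ≟ suc t))

  layeredDecomposition : (h : Fin (n G) → ℕ) (M : ℕ) → (∀ v → h v ≤ M) →
                         (∀ {u v} → Edge G u v → h v ≤ suc (h u)) → TreeDecompOn G Full
  layeredDecomposition h M h≤M h-edge = record
    { T       = Path (suc M)
    ; isTree  = path-isTree M
    ; bag     = λ x → twoLayers h (toℕ x)
    ; bag⊆S   = λ _ _ _ → ∈⊤
    ; cover   = λ v _ → node v , ∈-bag-node (inj₁ refl)
    ; edges   = edges
    ; subtree = subtree
    }
    where
    node : Fin (n G) → Fin (suc M)
    node v = fromℕ< (s≤s (h≤M v))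

    ∈-bag-node : ∀ {u w} → h w ≡ h u ⊎ h w ≡ suc (h u) → w ∈ twoLayers h (toℕ (node u))
    ∈-bag-node {u} hw =
      ∈-twoLayers⁺ h (toℕ (node u)) (subst (λ t → _ ≡ t ⊎ _ ≡ suc t) (sym (toℕ-fromℕ< _)) hw)

    between : ∀ {m k} → m ≤ k → k ≤ suc m → k ≡ m ⊎ k ≡ suc m
    between m≤k k≤1+m with m≤n⇒m<n∨m≡n k≤1+m
    ... | inj₁ k<1+m = inj₁ (≤-antisym (≤-pred k<1+m) m≤k)
    ... | inj₂ k≡1+m = inj₂ k≡1+m

    edges : ∀ u v → u ∈ Full → v ∈ Full → Edge G u v →
            ∃[ x ] (u ∈ twoLayers h (toℕ x) × v ∈ twoLayers h (toℕ x))
    edges u v _ _ e with ≤-total (h u) (h v)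
    ... | inj₁ hu≤hv = node u , ∈-bag-node (inj₁ refl) , ∈-bag-node (between hu≤hv (h-edge e))
    ... | inj₂ hv≤hu =
      node v , ∈-bag-node (between hv≤hu (h-edge (edge-sym G e))) , ∈-bag-node (inj₁ refl)

    same-node : ∀ {v x y} → v ∈ twoLayers h (toℕ x) → toℕ x ≡ toℕ y →
                Reach (Path (suc M)) (λ z → v ∈ twoLayers h (toℕ z)) x y
    same-node v∈x x≡y with toℕ-injective x≡y
    ... | refl = reach-refl _ v∈x

    subtree : ∀ v → ConnectedOn (Path (suc M)) (λ x → v ∈ twoLayers h (toℕ x))
    subtree v x y v∈x v∈y with ∈-twoLayers⁻ h (toℕ x) v∈x | ∈-twoLayers⁻ h (toℕ y) v∈y
    ... | inj₁ hv≡x   | inj₁ hv≡y   = same-node v∈x (trans (sym hv≡x) hv≡y)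
    ... | inj₂ hv≡1+x | inj₂ hv≡1+y = same-node v∈x (suc-injective (trans (sym hv≡1+x) hv≡1+y))
    ... | inj₁ hv≡x   | inj₂ hv≡1+y =
      reach-edge _ v∈x v∈y (edge-sym (Path _) {y} {x} (path-edge⁺ (trans (sym hv≡1+y) hv≡x)))
    ... | inj₂ hv≡1+x | inj₁ hv≡y   = reach-edge _ v∈x v∈y (path-edge⁺ (trans (sym hv≡1+x) hv≡y))

  small-treewidth : ∀ {B k} → ∣ B ∣ ≤ suc k → TreewidthOnAtMost G B k
  small-treewidth {B} ∣B∣≤1+k = decomposition , λ _ → ∣B∣≤1+k
    where
    decomposition : TreeDecompOn G B
    decomposition = record
      { T       = Path 1
      ; isTree  = path-isTree 0
      ; bag     = λ _ → B
      ; bag⊆S   = λ _ _ v∈B → v∈B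
      ; cover   = λ _ v∈B → zero , v∈B
      ; edges   = λ _ _ u∈B v∈B _ → zero , u∈B , v∈B
      ; subtree = λ { _ zero zero v∈B _ → reach-refl (Path 1) v∈B }
      }

record Embedding (G : Graph) (B : Subset (n G)) (H : Graph) : Set where
  field
    embed           : Fin (n G) → Fin (n H)
    injective       : ∀ {u v} → u ∈ B → v ∈ B → embed u ≡ embed v → u ≡ v
    preserves-edges : ∀ {u v} → u ∈ B → v ∈ B → Edge G u v → Edge H (embed u) (embed v)

treewidth-embedding : ∀ {G B H k} → Embedding G B H → TreewidthAtMost H k → TreewidthOnAtMost G B k
treewidth-embedding {G} {B} {H} {k} φ (D , small) = pullback , λ x →
  ≤-trans (injective⇒∣p∣≤∣q∣ embed (proj₂ ∘ ∈-bag⁻) λ u∈ v∈ →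
             injective (proj₁ (∈-bag⁻ u∈)) (proj₁ (∈-bag⁻ v∈)))
          (small x)
  where
  open Embedding φ
  open TreeDecompOn D

  bag′ : Fin (n T) → Subset (n G)
  bag′ x = toSubset (λ v → (v ∈? B) ×-dec (embed v ∈? bag x))

  ∈-bag⁺ : ∀ {x v} → v ∈ B → embed v ∈ bag x → v ∈ bag′ x
  ∈-bag⁺ {x} v∈B φv∈ = ∈-toSubset⁺ (λ v → (v ∈? B) ×-dec (embed v ∈? bag x)) (v∈B , φv∈)

  ∈-bag⁻ : ∀ {x v} → v ∈ bag′ x → v ∈ B × embed v ∈ bag x
  ∈-bag⁻ {x} = ∈-toSubset⁻ (λ v → (v ∈? B) ×-dec (embed v ∈? bag x))

  pullback : TreeDecompOn G B
  pullback = record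
    { T       = T
    ; isTree  = isTree
    ; bag     = bag′
    ; bag⊆S   = λ _ _ → proj₁ ∘ ∈-bag⁻
    ; cover   = λ v v∈B → let (x , φv∈) = cover (embed v) ∈⊤ in x , ∈-bag⁺ v∈B φv∈
    ; edges   = λ u v u∈B v∈B e →
        let (x , φu∈ , φv∈) = edges (embed u) (embed v) ∈⊤ ∈⊤ (preserves-edges u∈B v∈B e)
        in x , ∈-bag⁺ u∈B φu∈ , ∈-bag⁺ v∈B φv∈
    ; subtree = λ v x y v∈x v∈y →
        let (v∈B , φv∈x) = ∈-bag⁻ v∈x in
        reach-mono T (∈-bag⁺ v∈B) (subtree (embed v) x y φv∈x (proj₂ (∈-bag⁻ v∈y)))
    }

minor-trans : ∀ {A H G} → IsMinor A H → IsMinor H G → IsMinor A G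
minor-trans {A} {H} {G} α β = record
  { branch    = branch
  ; branch⊆S  = λ _ _ _ → ∈⊤
  ; nonempty  = λ a →
      let (h , h∈a) = α.nonempty a ; (v , v∈h) = β.nonempty h in v , ∈-branch⁺ h∈a v∈h
  ; disjoint  = λ a a′ v v∈a v∈a′ →
      let (h , h∈a , v∈h) = ∈-branch⁻ v∈a ; (h′ , h′∈a′ , v∈h′) = ∈-branch⁻ v∈a′
      in α.disjoint a a′ h h∈a (subst (_∈ α.branch a′) (sym (β.disjoint h h′ v v∈h v∈h′)) h′∈a′)
  ; connected = λ a u v u∈a v∈a →
      let (h , h∈a , u∈h) = ∈-branch⁻ u∈a ; (h′ , h′∈a , v∈h′) = ∈-branch⁻ v∈a
      in lift (proj₂ (α.connected a h h′ h∈a h′∈a)) u∈h v∈h′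
  ; edges     = λ a a′ e →
      let (h , h′ , h∈a , h′∈a′ , eH) = α.edges a a′ e
          (u , v , u∈h , v∈h′ , eG)   = β.edges h h′ eH
      in u , v , ∈-branch⁺ h∈a u∈h , ∈-branch⁺ h′∈a′ v∈h′ , eG
  }
  where
  module α = MinorModelOn α
  module β = MinorModelOn β

  branch? : ∀ a v → Dec (∃[ h ] (h ∈ α.branch a × v ∈ β.branch h))
  branch? a v = any? (λ h → (h ∈? α.branch a) ×-dec (v ∈? β.branch h))

  branch : Fin (n A) → Subset (n G)
  branch a = toSubset (branch? a)

  ∈-branch⁺ : ∀ {a h v} → h ∈ α.branch a → v ∈ β.branch h → v ∈ branch a
  ∈-branch⁺ {a} h∈a v∈h = ∈-toSubset⁺ (branch? a) (_ , h∈a , v∈h)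

  ∈-branch⁻ : ∀ {a v} → v ∈ branch a → ∃[ h ] (h ∈ α.branch a × v ∈ β.branch h)
  ∈-branch⁻ {a} = ∈-toSubset⁻ (branch? a)

  lift : ∀ {a h h′ l} → Walk H (_∈ α.branch a) h h′ l →
         ∀ {x y} → x ∈ β.branch h → y ∈ β.branch h′ → Reach G (_∈ branch a) x y
  lift (here h∈a) x∈h y∈h = reach-mono G (∈-branch⁺ h∈a) (β.connected _ _ _ x∈h y∈h)
  lift (step h∈a e wlk) x∈h y∈w with β.edges _ _ e
  ... | u , w , u∈h , w∈ , eG =
    reach-trans G (reach-mono G (∈-branch⁺ h∈a) (β.connected _ _ _ x∈h u∈h))
      (reach-trans G (reach-edge G (∈-branch⁺ h∈a u∈h) (∈-branch⁺ (walk-start H wlk) w∈) eG)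
        (lift wlk w∈ y∈w))

WithinTwoOf : (G : Graph) → Subset (n G) → Subset (n G) → Fin (n G) → Set
WithinTwoOf G X R v = AdjacentTo G v R ⊎ ∃[ w ] (w ∈ X × Edge G v w × AdjacentTo G w R)

record Hub (G : Graph) (X : Subset (n G)) : Set where
  field
    core           : Subset (n G)
    root           : Fin (n G)
    root∈core      : root ∈ core
    core-connected : ConnectedOn G (_∈ core)
    core-disjoint  : ∀ {v} → v ∈ core → v ∉ X
    within-two     : ∀ {v} → v ∈ X → WithinTwoOf G X core v

module Contraction {G : Graph} {X : Subset (n G)} (hub : Hub G X) where
  open Hub hub

  touches : Fin (n G) → Bool
  touches v = does (adjacentTo? G v core)

  -- Vertex zero is the contracted core, vertex suc i the i-th vertex of X.
  contractedAdj : Fin (suc ∣ X ∣) → Fin (suc ∣ X ∣) → Bool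
  contractedAdj zero    zero    = false
  contractedAdj zero    (suc j) = touches (enum X j)
  contractedAdj (suc i) zero    = touches (enum X i)
  contractedAdj (suc i) (suc j) = adj G (enum X i) (enum X j)

  contractedAdj-sym : ∀ i j → contractedAdj i j ≡ contractedAdj j i
  contractedAdj-sym zero    zero    = refl
  contractedAdj-sym zero    (suc j) = refl
  contractedAdj-sym (suc i) zero    = refl
  contractedAdj-sym (suc i) (suc j) = adj-sym G (enum X i) (enum X j)

  contractedAdj-irrefl : ∀ i → contractedAdj i i ≡ false
  contractedAdj-irrefl zero    = refl
  contractedAdj-irrefl (suc i) = adj-irrefl G (enum X i)

  H : Graph
  H = record
    { n          = suc ∣ X ∣
    ; adj        = contractedAdj
    ; adj-sym    = contractedAdj-sym
    ; adj-irrefl = contractedAdj-irrefl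
    }

  ⌜_⌝ : ∀ {v} → v ∈ X → Fin (n H)
  ⌜ v∈X ⌝ = suc (index X v∈X)

  touch-edge : ∀ {v} (v∈X : v ∈ X) → AdjacentTo G v core → Edge H zero ⌜ v∈X ⌝
  touch-edge v∈X v~core =
    dec-true (adjacentTo? G _ core) (subst (λ x → AdjacentTo G x core) (sym (enum-index X v∈X)) v~core)

  H-minor : IsMinor H G
  H-minor = record
    { branch    = branch
    ; branch⊆S  = λ _ _ _ → ∈⊤
    ; nonempty  = λ { zero → root , root∈core ; (suc i) → enum X i , x∈⁅x⁆ (enum X i) }
    ; disjoint  = disjoint
    ; connected = λ { zero → core-connected ; (suc i) → ⁅⁆-connected G (enum X i) }
    ; edges     = edges
    }
    where
    branch : Fin (n H) → Subset (n G)
    branch zero    = core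
    branch (suc i) = ⁅ enum X i ⁆

    core∌enum : ∀ {i v} → v ∈ core → v ∉ ⁅ enum X i ⁆
    core∌enum {i} v∈core v∈⁅⁆ =
      core-disjoint v∈core (subst (_∈ X) (sym (x∈⁅y⁆⇒x≡y _ v∈⁅⁆)) (enum-∈ X i))

    disjoint : ∀ h h′ v → v ∈ branch h → v ∈ branch h′ → h ≡ h′
    disjoint zero    zero    _ _    _     = refl
    disjoint zero    (suc j) _ v∈h  v∈h′  = ⊥-elim (core∌enum v∈h v∈h′)
    disjoint (suc i) zero    _ v∈h  v∈h′  = ⊥-elim (core∌enum v∈h′ v∈h)
    disjoint (suc i) (suc j) _ v∈h  v∈h′  =
      cong suc (enum-injective X (trans (sym (x∈⁅y⁆⇒x≡y _ v∈h)) (x∈⁅y⁆⇒x≡y _ v∈h′)))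

    edges : ∀ h h′ → Edge H h h′ → ∃[ u ] ∃[ v ] (u ∈ branch h × v ∈ branch h′ × Edge G u v)
    edges zero    (suc j) e = let (w , w∈core , e′) = witness (adjacentTo? G (enum X j) core) e
                              in w , enum X j , w∈core , x∈⁅x⁆ _ , edge-sym G e′
    edges (suc i) zero    e = let (w , w∈core , e′) = witness (adjacentTo? G (enum X i) core) e
                              in enum X i , w , x∈⁅x⁆ _ , w∈core , e′
    edges (suc i) (suc j) e = enum X i , enum X j , x∈⁅x⁆ _ , x∈⁅x⁆ _ , e

  H-radius : RadiusAtMost H 2
  H-radius = zero , λ { zero → 0 , z≤n , here ∈⊤ ; (suc i) → from-zero i }
    where
    from-zero : ∀ i → ∃[ k ] (k ≤ 2 × Walk H (_∈ Full) zero (suc i) k)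
    from-zero i with within-two (enum-∈ X i)
    ... | inj₁ v~core = 1 , s≤s z≤n , step ∈⊤ (dec-true (adjacentTo? G _ core) v~core) (here ∈⊤)
    ... | inj₂ (w , w∈X , e , w~core) =
      2 , ≤-refl , step {w = ⌜ w∈X ⌝} ∈⊤ (touch-edge w∈X w~core)
                     (step ∈⊤ (subst (λ x → Edge G x (enum X i)) (sym (enum-index X w∈X)) (edge-sym G e))
                        (here ∈⊤))

  module _ {B : Subset (n G)} (B⊆X+root : ∀ {v} → v ∈ B → v ∈ X ⊎ v ≡ root) where

    outside-X : ∀ {v} → v ∈ B → v ∉ X → v ≡ root
    outside-X v∈B v∉X = [ (λ v∈X → ⊥-elim (v∉X v∈X)) , (λ v≡root → v≡root) ]′ (B⊆X+root v∈B)

    position : ∀ {v} → Dec (v ∈ X) → Fin (n H)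
    position (yes v∈X) = ⌜ v∈X ⌝
    position (no _)    = zero

    H-embedding : Embedding G B H
    H-embedding = record
      { embed = λ v → position (v ∈? X) ; injective = injective ; preserves-edges = preserves-edges }
      where
      injective : ∀ {u v} → u ∈ B → v ∈ B → position (u ∈? X) ≡ position (v ∈? X) → u ≡ v
      injective {u} {v} u∈B v∈B eq with u ∈? X | v ∈? X
      ... | yes u∈X | yes v∈X = begin
        u                       ≡⟨ sym (enum-index X u∈X) ⟩
        enum X (index X u∈X)    ≡⟨ cong (enum X) (Finₚ.suc-injective eq) ⟩
        enum X (index X v∈X)    ≡⟨ enum-index X v∈X ⟩
        v                       ∎
        where open ≡-Reasoning
      ... | no u∉X  | no v∉X  = trans (outside-X u∈B u∉X) (sym (outside-X v∈B v∉X))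

      preserves-edges : ∀ {u v} → u ∈ B → v ∈ B → Edge G u v →
                        Edge H (position (u ∈? X)) (position (v ∈? X))
      preserves-edges {u} {v} u∈B v∈B e with u ∈? X | v ∈? X
      ... | yes u∈X | yes v∈X = subst₂ (Edge G) (sym (enum-index X u∈X)) (sym (enum-index X v∈X)) e
      ... | yes u∈X | no v∉X  =
        edge-sym H {zero} {⌜ u∈X ⌝}
          (touch-edge u∈X (v , subst (_∈ core) (sym (outside-X v∈B v∉X)) root∈core , e))
      ... | no u∉X  | yes v∈X =
        touch-edge v∈X (u , subst (_∈ core) (sym (outside-X u∈B u∉X)) root∈core , edge-sym G e)
      ... | no u∉X  | no v∉X  with trans (outside-X u∈B u∉X) (sym (outside-X v∈B v∉X))
      ...   | refl = ⊥-elim (edge-irrefl G e)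

Radius2TreewidthBound : Graph → ℕ → Set
Radius2TreewidthBound A k = ∀ (H : Graph) → ¬ IsMinor A H → RadiusAtMost H 2 → TreewidthAtMost H k

hub-treewidth : ∀ {A G k X B} → ¬ IsMinor A G → Radius2TreewidthBound A k → (hub : Hub G X) →
                (∀ {v} → v ∈ B → v ∈ X ⊎ v ≡ Hub.root hub) → TreewidthOnAtMost G B k
hub-treewidth A⋠G bound hub B⊆X+root =
  treewidth-embedding (H-embedding B⊆X+root) (bound H (A⋠G ∘ flip minor-trans H-minor) H-radius)
  where open Contraction hub

module Exploration (G : Graph) where

  -- The ball is the explored part of the component being searched.
  record State : Set where
    constructor ⟨_,_⟩
    field
      explored ball : Subset (n G)
  open State

  Frontier : State → Fin (n G) → Set
  Frontier s v = v ∉ explored s × AdjacentTo G v (ball s)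

  frontier : State → Subset (n G)
  frontier s = toSubset (λ v → ¬? (v ∈? explored s) ×-dec adjacentTo? G v (ball s))

  ∈-frontier⁺ : ∀ {s v} → Frontier s v → v ∈ frontier s
  ∈-frontier⁺ {s} = ∈-toSubset⁺ (λ v → ¬? (v ∈? explored s) ×-dec adjacentTo? G v (ball s))

  ∈-frontier⁻ : ∀ {s v} → v ∈ frontier s → Frontier s v
  ∈-frontier⁻ {s} = ∈-toSubset⁻ (λ v → ¬? (v ∈? explored s) ×-dec adjacentTo? G v (ball s))

  data Move (s : State) : State → Set where
    expand : Nonempty (frontier s) →
             Move s ⟨ explored s ∪ frontier s , ball s ∪ frontier s ⟩
    -- Closing the ball in a move of its own leaves an empty layer between components.
    close  : Empty (frontier s) → Nonempty (ball s) →
             Move s ⟨ explored s , ∅ ⟩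
    root   : ∀ x → x ∉ explored s → Empty (frontier s) → Empty (ball s) →
             Move s ⟨ explored s ∪ ⁅ x ⁆ , ⁅ x ⁆ ⟩
    halt   : Empty (frontier s) → Empty (ball s) → (∀ x → x ∈ explored s) →
             Move s s

  next : (s : State) → ∃ (Move s)
  next s with nonempty? (frontier s)
  ... | yes ∃F = _ , expand ∃F
  ... | no ∄F with nonempty? (ball s)
  ...   | yes ∃C = _ , close ∄F ∃C
  ...   | no ∄C with nonempty? (∁ (explored s))
  ...     | yes (x , x∈∁S) = _ , root x (x∈∁p⇒x∉p x∈∁S) ∄F ∄C
  ...     | no ∄∁S = _ , halt ∄F ∄C (λ x → x∉∁p⇒x∈p (λ x∈∁S → ∄∁S (x , x∈∁S)))

  run : ℕ → State
  run zero    = ⟨ ∅ , ∅ ⟩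
  run (suc t) = proj₁ (next (run t))

  move : ∀ t → Move (run t) (run (suc t))
  move t = proj₂ (next (run t))

  Entering : State → State → Fin (n G) → Set
  Entering s s′ v = v ∉ explored s × v ∈ explored s′

  Invariant : State → Set
  Invariant s = ball s ⊆ explored s × ConnectedOn G (_∈ ball s)

  -- Every move but halt raises it: expand and root explore new vertices, close empties the ball.
  potential : State → ℕ
  potential s = ∣ explored s ∣ + ∣ explored s ∩ ∁ (ball s) ∣

  module _ {s s′ : State} where

    Move-explored-mono : Move s s′ → explored s ⊆ explored s′
    Move-explored-mono (expand _)     = p⊆p∪q _
    Move-explored-mono (close _ _)    = λ x∈ → x∈
    Move-explored-mono (root _ _ _ _) = p⊆p∪q _
    Move-explored-mono (halt _ _ _)   = λ x∈ → x∈

    Move-explores-frontier : Move s s′ → frontier s ⊆ explored s′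
    Move-explores-frontier (expand _)      = q⊆p∪q _ _
    Move-explores-frontier (close ∄F _)    = λ v∈F → ⊥-elim (∄F (_ , v∈F))
    Move-explores-frontier (root _ _ ∄F _) = λ v∈F → ⊥-elim (∄F (_ , v∈F))
    Move-explores-frontier (halt ∄F _ _)   = λ v∈F → ⊥-elim (∄F (_ , v∈F))

    Move-entering-ball : Move s s′ → ∀ {v} → Entering s s′ v → v ∈ ball s′
    Move-entering-ball (expand _)     (v∉S , v∈S′) = q⊆p∪q _ _ (x∈p∪q∧x∉p⇒x∈q v∉S v∈S′)
    Move-entering-ball (close _ _)    (v∉S , v∈S)  = ⊥-elim (v∉S v∈S)
    Move-entering-ball (root _ _ _ _) (v∉S , v∈S′) = x∈p∪q∧x∉p⇒x∈q v∉S v∈S′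
    Move-entering-ball (halt _ _ _)   (v∉S , v∈S)  = ⊥-elim (v∉S v∈S)

    Move-entering-frontier : Nonempty (ball s) → Move s s′ → ∀ {v} → Entering s s′ v → v ∈ frontier s
    Move-entering-frontier _  (expand _)      (v∉S , v∈S′) = x∈p∪q∧x∉p⇒x∈q v∉S v∈S′
    Move-entering-frontier _  (close _ _)     (v∉S , v∈S)  = ⊥-elim (v∉S v∈S)
    Move-entering-frontier ∃C (root _ _ _ ∄C) _            = ⊥-elim (∄C ∃C)
    Move-entering-frontier _  (halt _ _ _)    (v∉S , v∈S)  = ⊥-elim (v∉S v∈S)

    Move-from-empty-ball : Empty (ball s) → Move s s′ →
                           ∃[ p ] (∣ p ∣ ≤ 1 × ∀ {v} → Entering s s′ v → v ∈ p)
    Move-from-empty-ball ∄C (expand (_ , v∈F)) =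
      let (_ , c , c∈C , _) = ∈-frontier⁻ v∈F in ⊥-elim (∄C (c , c∈C))
    Move-from-empty-ball ∄C (close _ ∃C)   = ⊥-elim (∄C ∃C)
    Move-from-empty-ball _  (root x _ _ _) =
      ⁅ x ⁆ , ≤-reflexive (∣⁅x⁆∣≡1 x) , λ (v∉S , v∈S′) → x∈p∪q∧x∉p⇒x∈q v∉S v∈S′
    Move-from-empty-ball _  (halt _ _ _)   =
      ∅ , ≤-trans (≤-reflexive (∣⊥∣≡0 (n G))) z≤n , λ (v∉S , v∈S) → ⊥-elim (v∉S v∈S)

    Move-invariant : Invariant s → Move s s′ → Invariant s′
    Move-invariant (C⊆S , C-connected) (expand _) = C∪F⊆S∪F , C∪F-connected
      where
      C∪F⊆S∪F : ball s ∪ frontier s ⊆ explored s ∪ frontier s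
      C∪F⊆S∪F x∈ = [ p⊆p∪q _ ∘ C⊆S , q⊆p∪q _ _ ]′ (x∈p∪q⁻ _ _ x∈)

      into-ball : ∀ {x} → x ∈ ball s ∪ frontier s →
                  ∃[ c ] (c ∈ ball s × Reach G (_∈ ball s ∪ frontier s) x c)
      into-ball {x} x∈ with x∈p∪q⁻ _ _ x∈
      ... | inj₁ x∈C = x , x∈C , reach-refl G x∈
      ... | inj₂ x∈F =
        let (_ , c , c∈C , e) = ∈-frontier⁻ x∈F in c , c∈C , reach-edge G x∈ (p⊆p∪q _ c∈C) e

      C∪F-connected : ConnectedOn G (_∈ ball s ∪ frontier s)
      C∪F-connected u v u∈ v∈ =
        let (cu , cu∈C , u⇝cu) = into-ball u∈ ; (cv , cv∈C , v⇝cv) = into-ball v∈ in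
        reach-trans G u⇝cu
          (reach-trans G (reach-mono G (p⊆p∪q _) (C-connected cu cv cu∈C cv∈C)) (reach-sym G v⇝cv))
    Move-invariant _ (close _ _)    = (λ x∈∅ → ⊥-elim (∉⊥ x∈∅)) , (λ _ _ u∈∅ → ⊥-elim (∉⊥ u∈∅))
    Move-invariant _ (root x _ _ _) = q⊆p∪q _ _ , ⁅⁆-connected G x
    Move-invariant inv (halt _ _ _) = inv

    Move-potential : ball s ⊆ explored s → Move s s′ →
                     (∀ v → v ∈ explored s) ⊎ potential s < potential s′
    Move-potential _ (expand (v , v∈F)) =
      inj₂ (+-mono-<-≤ (x∈q∧x∉p⇒∣p∣<∣p∪q∣ v∈F (proj₁ (∈-frontier⁻ v∈F))) (p⊆q⇒∣p∣≤∣q∣ finished-stay))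
      where
      finished-stay : explored s ∩ ∁ (ball s) ⊆ (explored s ∪ frontier s) ∩ ∁ (ball s ∪ frontier s)
      finished-stay x∈ =
        let (x∈S , x∈∁C) = x∈p∩q⁻ _ _ x∈ in
        x∈p∩q⁺ (p⊆p∪q _ x∈S , x∉p⇒x∈∁p λ x∈C∪F →
          [ x∈∁p⇒x∉p x∈∁C , (λ x∈F → proj₁ (∈-frontier⁻ x∈F) x∈S) ]′ (x∈p∪q⁻ _ _ x∈C∪F))
    Move-potential C⊆S (close _ (c , c∈C)) =
      inj₂ (+-monoʳ-< ∣ explored s ∣
             (p⊂q⇒∣p∣<∣q∣ (finished-grow , c , x∈p∩q⁺ (C⊆S c∈C , x∉p⇒x∈∁p ∉⊥) , c-unfinished)))
      where
      finished-grow : explored s ∩ ∁ (ball s) ⊆ explored s ∩ ∁ ∅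
      finished-grow x∈ = x∈p∩q⁺ (proj₁ (x∈p∩q⁻ _ _ x∈) , x∉p⇒x∈∁p ∉⊥)

      c-unfinished : c ∉ explored s ∩ ∁ (ball s)
      c-unfinished c∈ = x∈∁p⇒x∉p (proj₂ (x∈p∩q⁻ _ _ c∈)) c∈C
    Move-potential _ (root x x∉S _ ∄C) =
      inj₂ (+-mono-<-≤ (x∈q∧x∉p⇒∣p∣<∣p∪q∣ (x∈⁅x⁆ x) x∉S) (p⊆q⇒∣p∣≤∣q∣ finished-stay))
      where
      finished-stay : explored s ∩ ∁ (ball s) ⊆ (explored s ∪ ⁅ x ⁆) ∩ ∁ ⁅ x ⁆
      finished-stay y∈ =
        let (y∈S , _) = x∈p∩q⁻ _ _ y∈ in
        x∈p∩q⁺ (p⊆p∪q _ y∈S , x∉p⇒x∈∁p λ y∈⁅x⁆ →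
          x∉S (subst (_∈ explored s) (x∈⁅y⁆⇒x≡y x y∈⁅x⁆) y∈S))
    Move-potential _ (halt _ _ all) = inj₁ all

  potential≤ : ∀ s → potential s ≤ n G + n G
  potential≤ s = +-mono-≤ (∣p∣≤n (explored s)) (∣p∣≤n (explored s ∩ ∁ (ball s)))

  invariant : ∀ t → Invariant (run t)
  invariant zero    = (λ x∈∅ → ⊥-elim (∉⊥ x∈∅)) , (λ _ _ u∈∅ → ⊥-elim (∉⊥ u∈∅))
  invariant (suc t) = Move-invariant (invariant t) (move t)

  run-explored-mono : ∀ {s t} → s ≤ t → explored (run s) ⊆ explored (run t)
  run-explored-mono s≤t = go (≤⇒≤′ s≤t)
    where
    go : ∀ {s t} → s ≤′ t → explored (run s) ⊆ explored (run t)
    go ≤′-refl                    x∈ = x∈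
    go {t = suc t} (≤′-step s≤t) x∈ = Move-explored-mono (move t) (go s≤t x∈)

  explored-all-or-potential : ∀ t → (∀ v → v ∈ explored (run t)) ⊎ t ≤ potential (run t)
  explored-all-or-potential zero = inj₂ z≤n
  explored-all-or-potential (suc t)
    with explored-all-or-potential t | Move-potential (proj₁ (invariant t)) (move t)
  ... | inj₁ all   | _         = inj₁ (Move-explored-mono (move t) ∘ all)
  ... | inj₂ _     | inj₁ all  = inj₁ (Move-explored-mono (move t) ∘ all)
  ... | inj₂ t≤pot | inj₂ pot< = inj₂ (≤-trans (s≤s t≤pot) pot<)

  horizon : ℕ
  horizon = suc (n G + n G)

  explored-eventually : ∀ v → v ∈ explored (run horizon)
  explored-eventually v with explored-all-or-potential horizon
  ... | inj₁ all       = all v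
  ... | inj₂ horizon≤p = ⊥-elim (1+n≰n (≤-trans horizon≤p (potential≤ (run horizon))))

  entry : ∀ v → ∃[ t ] Entering (run t) (run (suc t)) v
  entry v = crossing (λ t → v ∈? explored (run t)) ∉⊥ {horizon} (explored-eventually v)

  layer : Fin (n G) → ℕ
  layer v = proj₁ (entry v)

  layer-entering : ∀ v → Entering (run (layer v)) (run (suc (layer v))) v
  layer-entering v = proj₂ (entry v)

  explored⇒layer< : ∀ {v t} → v ∈ explored (run t) → layer v < t
  explored⇒layer< {v} {t} v∈ =
    decidable-stable (layer v <? t) λ layer≮t →
      proj₁ (layer-entering v) (run-explored-mono (≮⇒≥ layer≮t) v∈)

  layer≡⇒entering : ∀ {v t} → layer v ≡ t → Entering (run t) (run (suc t)) v
  layer≡⇒entering {v} refl = layer-entering v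

  layer≤ : ∀ v → layer v ≤ n G + n G
  layer≤ v = ≤-pred (explored⇒layer< (explored-eventually v))

  Move²-explores-neighbours : ∀ {s₀ s₁ s₂ u v} → Move s₀ s₁ → Move s₁ s₂ →
                              Entering s₀ s₁ u → Edge G u v → v ∈ explored s₂
  Move²-explores-neighbours {s₁ = s₁} {v = v} move₀ move₁ u-enters e with v ∈? explored s₁
  ... | yes v∈S₁ = Move-explored-mono move₁ v∈S₁
  ... | no  v∉S₁ = Move-explores-frontier move₁
                     (∈-frontier⁺ (v∉S₁ , _ , Move-entering-ball move₀ u-enters , edge-sym G e))

  layer-edge : ∀ {u v} → Edge G u v → layer v ≤ suc (layer u)
  layer-edge {u} e = ≤-pred (explored⇒layer<
    (Move²-explores-neighbours (move (layer u)) (move (suc (layer u))) (layer-entering u) e))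

  discovered : State → State → Subset (n G)
  discovered s s′ = explored s′ ∩ ∁ (explored s)

  module _ (s s′ : State) {v : Fin (n G)} where

    ∈-discovered⁺ : Entering s s′ v → v ∈ discovered s s′
    ∈-discovered⁺ (v∉S , v∈S′) = x∈p∩q⁺ (v∈S′ , x∉p⇒x∈∁p v∉S)

    ∈-discovered⁻ : v ∈ discovered s s′ → Entering s s′ v
    ∈-discovered⁻ v∈ = let (v∈S′ , v∈∁S) = x∈p∩q⁻ _ _ v∈ in x∈∁p⇒x∉p v∈∁S , v∈S′

  expansion-hub : ∀ {s s₂} → Invariant s → Nonempty (frontier s) →
                  Move ⟨ explored s ∪ frontier s , ball s ∪ frontier s ⟩ s₂ → Hub G (discovered s s₂)
  expansion-hub {s} {s₂} (C⊆S , C-connected) (_ , v₀∈F) move₁ with ∈-frontier⁻ v₀∈F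
  ... | _ , r , r∈C , _ = record
    { core           = ball s
    ; root           = r
    ; root∈core      = r∈C
    ; core-connected = C-connected
    ; core-disjoint  = λ c∈C c∈X → proj₁ (∈-discovered⁻ s s₂ c∈X) (C⊆S c∈C)
    ; within-two     = within-two
    }
    where
    within-two : ∀ {v} → v ∈ discovered s s₂ → WithinTwoOf G (discovered s s₂) (ball s) v
    within-two {v} v∈X with ∈-discovered⁻ s s₂ v∈X | v ∈? (explored s ∪ frontier s)
    ... | v∉S , _    | yes v∈S₁ = inj₁ (proj₂ (∈-frontier⁻ (x∈p∪q∧x∉p⇒x∈q v∉S v∈S₁)))
    ... | v∉S , v∈S₂ | no  v∉S₁
      with ∈-frontier⁻ (Move-entering-frontier (r , p⊆p∪q _ r∈C) move₁ (v∉S₁ , v∈S₂))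
    ...   | _ , w , w∈C∪F , e with x∈p∪q⁻ _ _ w∈C∪F
    ...     | inj₁ w∈C = ⊥-elim (v∉S₁ (q⊆p∪q _ _ (∈-frontier⁺ (v∉S , w , w∈C , e))))
    ...     | inj₂ w∈F = let (w∉S , w~C) = ∈-frontier⁻ w∈F in
      inj₂ (w , ∈-discovered⁺ s s₂ (w∉S , Move-explored-mono move₁ (q⊆p∪q _ _ w∈F)) , e , w~C)

  root-hub : ∀ {S s₂} x → Move ⟨ S ∪ ⁅ x ⁆ , ⁅ x ⁆ ⟩ s₂ → Hub G (discovered ⟨ S ∪ ⁅ x ⁆ , ⁅ x ⁆ ⟩ s₂)
  root-hub {S} {s₂} x move₁ = record
    { core           = ⁅ x ⁆
    ; root           = x
    ; root∈core      = x∈⁅x⁆ x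
    ; core-connected = ⁅⁆-connected G x
    ; core-disjoint  = λ c∈⁅x⁆ c∈X → proj₁ (∈-discovered⁻ s₁ s₂ c∈X) (q⊆p∪q _ _ c∈⁅x⁆)
    ; within-two     = λ v∈X →
        inj₁ (proj₂ (∈-frontier⁻ (Move-entering-frontier (x , x∈⁅x⁆ x) move₁ (∈-discovered⁻ s₁ s₂ v∈X))))
    }
    where
    s₁ : State
    s₁ = ⟨ S ∪ ⁅ x ⁆ , ⁅ x ⁆ ⟩

  unchanged : ∀ {S : Subset (n G)} {v} {Y : Set} → (v ∉ S × v ∈ S) ⊎ Y → Y
  unchanged = [ (λ (v∉S , v∈S) → ⊥-elim (v∉S v∈S)) , (λ y → y) ]′

  empty-ball-treewidth : ∀ {s₁ s₂ B k} → Empty (ball s₁) → Move s₁ s₂ →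
                         (∀ {v} → v ∈ B → Entering s₁ s₂ v) → TreewidthOnAtMost G B k
  empty-ball-treewidth ∄C move₁ B⊆ =
    let (p , ∣p∣≤1 , ⊆p) = Move-from-empty-ball ∄C move₁ in
    small-treewidth G (≤-trans (p⊆q⇒∣p∣≤∣q∣ (λ v∈B → ⊆p (B⊆ v∈B))) (≤-trans ∣p∣≤1 (s≤s z≤n)))

  module _ {A k} (A⋠G : ¬ IsMinor A G) (bound : Radius2TreewidthBound A k) where

    two-moves-treewidth : ∀ {s₀ s₁ s₂ B} → Invariant s₀ → Move s₀ s₁ → Move s₁ s₂ →
                          (∀ {v} → v ∈ B → Entering s₀ s₁ v ⊎ Entering s₁ s₂ v) →
                          TreewidthOnAtMost G B k
    two-moves-treewidth {s₀} {s₂ = s₂} inv (expand ∃F) move₁ B⊆ =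
      hub-treewidth A⋠G bound (expansion-hub inv ∃F move₁) λ v∈B →
        inj₁ (∈-discovered⁺ s₀ s₂ ([ (λ (v∉S₀ , v∈S₁) → v∉S₀ , Move-explored-mono move₁ v∈S₁)
                                   , (λ (v∉S₁ , v∈S₂) → v∉S₁ ∘ p⊆p∪q _ , v∈S₂)
                                   ]′ (B⊆ v∈B)))
    two-moves-treewidth {s₁ = s₁} {s₂} _ (root x _ _ _) move₁ B⊆ =
      hub-treewidth A⋠G bound (root-hub x move₁) λ v∈B →
        [ (λ (v∉S₀ , v∈S₁) → inj₂ (x∈⁅y⁆⇒x≡y x (x∈p∪q∧x∉p⇒x∈q v∉S₀ v∈S₁)))
        , inj₁ ∘ ∈-discovered⁺ s₁ s₂
        ]′ (B⊆ v∈B)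
    two-moves-treewidth _ (close _ _) move₁ B⊆ =
      empty-ball-treewidth (λ (_ , x∈∅) → ∉⊥ x∈∅) move₁ λ v∈B → unchanged (B⊆ v∈B)
    two-moves-treewidth _ (halt _ ∄C _) move₁ B⊆ =
      empty-ball-treewidth ∄C move₁ λ v∈B → unchanged (B⊆ v∈B)

    twoLayers-treewidth : ∀ t → TreewidthOnAtMost G (twoLayers G layer t) k
    twoLayers-treewidth t = two-moves-treewidth (invariant t) (move t) (move (suc t))
      (Sum.map layer≡⇒entering layer≡⇒entering ∘ ∈-twoLayers⁻ G layer t)

theorem16 : (A G : Graph) → IsApex A → ¬ IsMinor A G → (k : ℕ) →
    (∀ (H : Graph) → ¬ IsMinor A H → RadiusAtMost H 2 → TreewidthAtMost H k) →
    TreeTreewidthAtMost G k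
-- The apex hypothesis only serves to make g(A, 2) finite; here the bound k is given.
theorem16 A G _ A⋠G k bound =
  layeredDecomposition G layer (n G + n G) layer≤ layer-edge , twoLayers-treewidth A⋠G bound ∘ toℕ
  where open Exploration G
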